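{- Let $n \ge 1$ and $s \in \mathbb{Z}$. (a) If $-\lfloor (n-1)/2 \rfloor \le s \le n-1$, then with $n_s = n - s - 1$, $$H_s(n) = \sum_{k = \max(0,-s)}^{\lfloor n_s/3 \rfloor} \binom{2k+s}{k} \binom{n_s - 2k}{k},$$ and $H_s(n) = 0$ for all other integers $s$. (b) If $-\lfloor n/2 \rfloor \le s \le \max(0, n-3)$, then with $n'_s = n - s$, $$T_s(n) = 1_{s=0} + \sum_{k = \max(1,-s)}^{\lfloor n'_s/3 \rfloor} \binom{2k+s-1}{k-1} \binom{n'_s - 2k}{k},$$ and $T_s(n) = 0$ for all other integers $s$.
   Context: For a binary sequence $x = (x_1,\dots,x_n) \in \{0,1\}^n$ define the score $$S(x) = \sum_{i=1}^{n-1} I[x_i = x_{i+1} = 1] - \sum_{i=1}^{n-1} I[x_i = 1,\ x_{i+1} = 0].$$ For $s \in \mathbb{Z}$, $H_s(n)$ denotes the number of $x \in \{0,1\}^n$ with $x_n = 1$ and $S(x) = s$ ("heady-$s$" sequences), and $T_s(n)$ the number of $x \in \{0,1\}^n$ with $x_n = 0$ and $S(x) = s$ ("taily-$s$" sequences). $1_{s=0}$ is $1$ if $s=0$ and $0$ otherwise; empty sums equal $0$. -}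

module Defs where

open import Data.Bool using (Bool; true; false)
open import Data.Nat as ℕ using (ℕ; zero; suc; _∸_)
open import Data.Nat.Combinatorics using (_C_)
open import Data.Integer as ℤ using (ℤ; +_; -[1+_]; ∣_∣)
import Data.Integer.Properties as ℤP
open import Data.List using (List; []; _∷_; map; concatMap; filter; length; last; upTo)
open import Data.Nat.ListAction using (sum)
open import Data.Maybe using (Maybe; just; nothing)
open import Data.Product using (_×_; _,_)
open import Relation.Nullary using (Dec; yes; no; ¬_)
open import Relation.Nullary.Decidable using (_×-dec_)
import Data.Maybe.Properties as MP
import Data.Bool.Properties as BP
open import Relation.Binary.PropositionalEquality using (_≡_)

-- all binary sequences of length n (as lists of Booleans, true = 1)
allSeqs : ℕ → List (List Bool)
allSeqs zero    = [] ∷ []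
allSeqs (suc n) = concatMap (λ xs → (false ∷ xs) ∷ (true ∷ xs) ∷ []) (allSeqs n)

pairScore : Bool → Bool → ℤ
pairScore true true  = + 1
pairScore true false = ℤ.- (+ 1)
pairScore false _    = + 0

score : List Bool → ℤ
score (a ∷ b ∷ rest) = pairScore a b ℤ.+ score (b ∷ rest)
score _              = + 0

isEnd? : (b : Bool) (s : ℤ) (x : List Bool) → Dec ((last x ≡ just b) × (score x ≡ s))
isEnd? b s x = MP.≡-dec BP._≟_ (last x) (just b) ×-dec (score x ℤ.≟ s)

H : ℤ → ℕ → ℕ
H s n = length (filter (isEnd? true s) (allSeqs n))

T : ℤ → ℕ → ℕ
T s n = length (filter (isEnd? false s) (allSeqs n))

-- Σ_{k = lo}^{hi} f k   (empty, i.e. 0, when hi < lo)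
sumFromTo : ℕ → ℕ → (ℕ → ℕ) → ℕ
sumFromTo lo hi f = sum (map (λ i → f (lo ℕ.+ i)) (upTo (suc hi ∸ lo)))

indic0 : ℤ → ℕ
indic0 s with s ℤ.≟ + 0
... | yes _ = 1
... | no  _ = 0

-- Appending a letter to a sequence of length n + 1 gives
--   H_s(n+2) = H_{s-1}(n+1) + T_s(n+1),   T_s(n+2) = H_{s+1}(n+1) + T_s(n+1),
-- with H_s(1) = T_s(1) = 1_{s=0}.  Let binomial coefficients with a negative top be 0.
-- Then the sums over all k ≥ 0 of C(2k+s, k) C(n-s-1-2k, k), and 1_{s=0} plus the sums
-- over all k ≥ 1 of C(2k+s-1, k-1) C(n-s-2k, k), satisfy the same recurrences and initial
-- values: Pascal's rule splits the first factor in the heady case and the second one in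
-- the taily case.  The first factor vanishes for k < -s and the second for 3k > n_s
-- (resp. n'_s), which cuts the sums down to the stated ranges; for s outside the stated
-- ranges either the second factor always vanishes or the range of k is empty.
module Submission where

open import Defs
import Data.Nat.Properties as NP
import Data.Integer.Properties as ℤP
open import Algebra.Properties.AbelianGroup ℤP.+-0-abelianGroup using (∙-cancelʳ)
open import Algebra.Properties.CommutativeSemigroup NP.+-commutativeSemigroup
  using (interchange; x∙yz≈y∙xz)
open import Data.Bool using (Bool; true; false)
open import Data.Empty using (⊥-elim)
open import Data.Integer as ℤ using (ℤ; +_; -[1+_]; ∣_∣; _⊖_)
open import Data.Integer.Tactic.RingSolver using (solve-∀)
open import Data.List
  using (List; []; _∷_; _∷ʳ_; map; concatMap; filter; length; last; applyUpTo)
open import Data.List.Properties using (map-cong; map-upTo)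
open import Data.Maybe using (just)
open import Data.Nat as ℕ using (ℕ; zero; suc; _+_; _*_; _∸_; _/_; _≤_; _<_; s≤s; z≤n)
open import Data.Nat.Combinatorics using (_C_; nCk+nC[k+1]≡[n+1]C[k+1]; k>n⇒nCk≡0)
open import Data.Nat.DivMod using (m*n/n≡m; /-monoˡ-≤; m<n*o⇒m/o<n; m<n⇒m/n≡0)
open import Data.Nat.ListAction using (sum)
open import Data.Product using (_×_; _,_; ∃; proj₁; proj₂)
open import Function using (mk⇔)
open import Relation.Binary.PropositionalEquality
open import Relation.Nullary using (yes; no; does; ¬_)
open import Relation.Nullary.Decidable using (does-⇔)
open import Relation.Unary using (Decidable)

-- Finite sums

⟦_⟧ : Bool → ℕ
⟦ true  ⟧ = 1
⟦ false ⟧ = 0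

length-filter≡sum : ∀ {A : Set} {P : A → Set} (P? : Decidable P) xs →
  length (filter P? xs) ≡ sum (map (λ x → ⟦ does (P? x) ⟧) xs)
length-filter≡sum P? []       = refl
length-filter≡sum P? (x ∷ xs) with does (P? x)
... | true  = cong suc (length-filter≡sum P? xs)
... | false = length-filter≡sum P? xs

sum-map-+ : ∀ {A : Set} (f g : A → ℕ) xs →
  sum (map (λ x → f x + g x) xs) ≡ sum (map f xs) + sum (map g xs)
sum-map-+ f g []       = refl
sum-map-+ f g (x ∷ xs) =
  trans (cong (_+_ (f x + g x)) (sum-map-+ f g xs)) (interchange (f x) (g x) _ _)

sum-map-0 : ∀ {A : Set} (xs : List A) → sum (map (λ _ → 0) xs) ≡ 0
sum-map-0 []       = refl
sum-map-0 (_ ∷ xs) = sum-map-0 xs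

Σ< : ℕ → (ℕ → ℕ) → ℕ
Σ< N g = sum (applyUpTo g N)

Σ<-cong : ∀ N {g h : ℕ → ℕ} → (∀ k → g k ≡ h k) → Σ< N g ≡ Σ< N h
Σ<-cong zero    _   = refl
Σ<-cong (suc N) g≗h = cong₂ _+_ (g≗h 0) (Σ<-cong N (λ k → g≗h (suc k)))

Σ<-+ : ∀ N (g h : ℕ → ℕ) → Σ< N (λ k → g k + h k) ≡ Σ< N g + Σ< N h
Σ<-+ zero    g h = refl
Σ<-+ (suc N) g h =
  trans (cong (_+_ (g 0 + h 0)) (Σ<-+ N (λ k → g (suc k)) (λ k → h (suc k))))
        (interchange (g 0) (h 0) _ _)

Σ<-zero : ∀ N {g : ℕ → ℕ} → (∀ k → k < N → g k ≡ 0) → Σ< N g ≡ 0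
Σ<-zero zero    _   = refl
Σ<-zero (suc N) g≡0 =
  cong₂ _+_ (g≡0 0 (s≤s z≤n)) (Σ<-zero N (λ k k<N → g≡0 (suc k) (s≤s k<N)))

Σ<-++ : ∀ m n (g : ℕ → ℕ) → Σ< (m + n) g ≡ Σ< m g + Σ< n (λ k → g (m + k))
Σ<-++ zero    n g = refl
Σ<-++ (suc m) n g =
  trans (cong (_+_ (g 0)) (Σ<-++ m n (λ k → g (suc k)))) (sym (NP.+-assoc (g 0) _ _))

sumFromTo≡Σ< : ∀ lo hi f → sumFromTo lo hi f ≡ Σ< (suc hi ∸ lo) (λ i → f (lo + i))
sumFromTo≡Σ< lo hi f = cong sum (map-upTo (λ i → f (lo + i)) (suc hi ∸ lo))

Σ<-support : ∀ lo hi R {g f : ℕ → ℕ} →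
  (∀ k → k < lo → g k ≡ 0) → (∀ k → lo ≤ k → g k ≡ f k) → (∀ k → hi < k → f k ≡ 0) →
  Σ< (lo + (suc hi ∸ lo) + R) g ≡ sumFromTo lo hi f
Σ<-support lo hi R {g} {f} below agree above = begin
  Σ< (lo + L + R) g                             ≡⟨ Σ<-++ (lo + L) R g ⟩
  Σ< (lo + L) g + Σ< R (λ i → g (lo + L + i))   ≡⟨ cong₂ _+_ (Σ<-++ lo L g) (Σ<-zero R beyond) ⟩
  Σ< lo g + Σ< L (λ i → g (lo + i)) + 0         ≡⟨ NP.+-identityʳ _ ⟩
  Σ< lo g + Σ< L (λ i → g (lo + i))             ≡⟨ cong₂ _+_ (Σ<-zero lo below) (Σ<-cong L inside) ⟩
  Σ< L (λ i → f (lo + i))                       ≡⟨ sumFromTo≡Σ< lo hi f ⟨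
  sumFromTo lo hi f                             ∎
  where
  open ≡-Reasoning
  L = suc hi ∸ lo
  inside : ∀ i → g (lo + i) ≡ f (lo + i)
  inside i = agree (lo + i) (NP.m≤m+n lo i)
  beyond : ∀ i → i < R → g (lo + L + i) ≡ 0
  beyond i _ = trans (agree _ (NP.≤-trans (NP.m≤m+n lo L) (NP.m≤m+n (lo + L) i)))
                     (above _ (NP.≤-trans (NP.m≤n+m∸n (suc hi) lo) (NP.m≤m+n (lo + L) i)))

sumFromTo-empty : ∀ {lo hi} f → hi < lo → sumFromTo lo hi f ≡ 0
sumFromTo-empty f hi<lo rewrite NP.m≤n⇒m∸n≡0 hi<lo = refl

-- Binomial coefficients with an integer top

_Cℤ_ : ℤ → ℕ → ℕ
(+ m)    Cℤ k = m C k
-[1+ _ ] Cℤ k = 0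

Cℤ-pascal : ∀ a k → (+ 1 ℤ.+ a) Cℤ suc k ≡ a Cℤ suc k + a Cℤ k
Cℤ-pascal (+ m)        k = trans (sym (nCk+nC[k+1]≡[n+1]C[k+1] m k)) (NP.+-comm (m C k) _)
Cℤ-pascal -[1+ zero ]  k = refl
Cℤ-pascal -[1+ suc _ ] k = refl

0<x⇒[-x]Cℤk≡0 : ∀ {x} k → 0 < x → (ℤ.- + x) Cℤ k ≡ 0
0<x⇒[-x]Cℤk≡0 {suc _} k _ = refl

m<n+k⇒[m⊖n]Cℤk≡0 : ∀ m n k → m < n + k → (m ⊖ n) Cℤ k ≡ 0
m<n+k⇒[m⊖n]Cℤk≡0 m n k m<n+k with n ℕ.≤? m
... | yes n≤m rewrite ℤP.⊖-≥ n≤m =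
  k>n⇒nCk≡0 (NP.+-cancelˡ-< n (m ∸ n) k (subst (_< n + k) (sym (NP.m+[n∸m]≡n n≤m)) m<n+k))
... | no  n≰m rewrite ℤP.⊖-< (NP.≰⇒> n≰m) = 0<x⇒[-x]Cℤk≡0 k (NP.m<n⇒0<n∸m (NP.≰⇒> n≰m))

aCℤj*[-a]Cℤ[1+m]≡0 : ∀ a j m → a Cℤ j * (ℤ.- a) Cℤ suc m ≡ 0
aCℤj*[-a]Cℤ[1+m]≡0 (+ zero)  j m = NP.*-zeroʳ (0 C j)
aCℤj*[-a]Cℤ[1+m]≡0 (+ suc p) j m = NP.*-zeroʳ (suc p C j)
aCℤj*[-a]Cℤ[1+m]≡0 -[1+ _ ]  j m = refl

m/n<o⇒m<o*n : ∀ {m n o} .{{_ : ℕ.NonZero n}} → m / n < o → m < o * n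
m/n<o⇒m<o*n {m} {n} {o} m/n<o = NP.≰⇒> λ o*n≤m →
  NP.<⇒≱ m/n<o (subst (_≤ m / n) (m*n/n≡m o n) (/-monoˡ-≤ n o*n≤m))

c/3<k⇒[c∸2k]Ck≡0 : ∀ c {k} → c / 3 < k → (c ∸ 2 * k) C k ≡ 0
c/3<k⇒[c∸2k]Ck≡0 c {suc j} c/3<k = k>n⇒nCk≡0 (NP.m<n+o⇒m∸n<o c (2 * suc j) c<2k+k)
  where
  c<2k+k : c < 2 * suc j + suc j
  c<2k+k = subst (c <_) (trans (NP.*-comm (suc j) 3) (NP.+-comm (suc j) _)) (m/n<o⇒m<o*n c/3<k)

-- Counting sequences by their last letter

Σseq : ℕ → (List Bool → ℕ) → ℕ
Σseq n f = sum (map f (allSeqs n))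

Σseq-cong : ∀ n {f g : List Bool → ℕ} → (∀ x → f x ≡ g x) → Σseq n f ≡ Σseq n g
Σseq-cong n f≗g = cong sum (map-cong f≗g (allSeqs n))

Σseq-+ : ∀ n (f g : List Bool → ℕ) → Σseq n (λ x → f x + g x) ≡ Σseq n f + Σseq n g
Σseq-+ n f g = sum-map-+ f g (allSeqs n)

Σseq-0 : ∀ n → Σseq n (λ _ → 0) ≡ 0
Σseq-0 n = sum-map-0 (allSeqs n)

Σseq-∷ : ∀ n f → Σseq (suc n) f ≡ Σseq n (λ x → f (false ∷ x)) + Σseq n (λ x → f (true ∷ x))
Σseq-∷ n f = go (allSeqs n)
  where
  go : ∀ L → sum (map f (concatMap (λ xs → (false ∷ xs) ∷ (true ∷ xs) ∷ []) L))
           ≡ sum (map (λ x → f (false ∷ x)) L) + sum (map (λ x → f (true ∷ x)) L)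
  go []      = refl
  go (x ∷ L) = begin
    f₀ + (f₁ + _)         ≡⟨ cong (λ r → f₀ + (f₁ + r)) (go L) ⟩
    f₀ + (f₁ + (A + B))   ≡⟨ NP.+-assoc f₀ f₁ (A + B) ⟨
    f₀ + f₁ + (A + B)     ≡⟨ interchange f₀ f₁ A B ⟩
    (f₀ + A) + (f₁ + B)   ∎
    where
    open ≡-Reasoning
    f₀ = f (false ∷ x)
    f₁ = f (true ∷ x)
    A = sum (map (λ x → f (false ∷ x)) L)
    B = sum (map (λ x → f (true ∷ x)) L)

Σseq-∷ʳ : ∀ n f → Σseq (suc n) f ≡ Σseq n (λ x → f (x ∷ʳ false)) + Σseq n (λ x → f (x ∷ʳ true))
Σseq-∷ʳ zero    f = sym (cong (_+ (f (true ∷ []) + 0)) (NP.+-identityʳ (f (false ∷ []))))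
Σseq-∷ʳ (suc n) f = begin
  Σseq (2 + n) f                        ≡⟨ Σseq-∷ (suc n) f ⟩
  Σseq (suc n) f₀ + Σseq (suc n) f₁     ≡⟨ cong₂ _+_ (Σseq-∷ʳ n f₀) (Σseq-∷ʳ n f₁) ⟩
  (s₀₀ + s₀₁) + (s₁₀ + s₁₁)             ≡⟨ interchange s₀₀ s₀₁ s₁₀ s₁₁ ⟩
  (s₀₀ + s₁₀) + (s₀₁ + s₁₁)             ≡⟨ cong₂ _+_ (Σseq-∷ n _) (Σseq-∷ n _) ⟨
  Σseq (suc n) (λ x → f (x ∷ʳ false)) + Σseq (suc n) (λ x → f (x ∷ʳ true)) ∎
  where
  open ≡-Reasoning
  f₀ f₁ : List Bool → ℕ
  f₀ x = f (false ∷ x)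
  f₁ x = f (true ∷ x)
  s₀₀ s₀₁ s₁₀ s₁₁ : ℕ
  s₀₀ = Σseq n (λ x → f₀ (x ∷ʳ false))
  s₀₁ = Σseq n (λ x → f₀ (x ∷ʳ true))
  s₁₀ = Σseq n (λ x → f₁ (x ∷ʳ false))
  s₁₁ = Σseq n (λ x → f₁ (x ∷ʳ true))

last-∷ : ∀ (a : Bool) xs → ∃ λ ℓ → last (a ∷ xs) ≡ just ℓ
last-∷ a []       = a , refl
last-∷ a (b ∷ xs) = last-∷ b xs

Σseq-cong-nonempty : ∀ n {f g : List Bool → ℕ} →
  (∀ x {ℓ} → last x ≡ just ℓ → f x ≡ g x) → Σseq (suc n) f ≡ Σseq (suc n) g
Σseq-cong-nonempty n {f} {g} f≗g = begin
  Σseq (suc n) f                                             ≡⟨ Σseq-∷ n f ⟩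
  Σseq n (λ x → f (false ∷ x)) + Σseq n (λ x → f (true ∷ x))
    ≡⟨ cong₂ _+_ (Σseq-cong n (agree false)) (Σseq-cong n (agree true)) ⟩
  Σseq n (λ x → g (false ∷ x)) + Σseq n (λ x → g (true ∷ x)) ≡⟨ Σseq-∷ n g ⟨
  Σseq (suc n) g                                             ∎
  where
  open ≡-Reasoning
  agree : ∀ a xs → f (a ∷ xs) ≡ g (a ∷ xs)
  agree a xs = f≗g (a ∷ xs) (proj₂ (last-∷ a xs))

last-∷ʳ : ∀ (x : List Bool) c → last (x ∷ʳ c) ≡ just c
last-∷ʳ []          c = refl
last-∷ʳ (_ ∷ [])    c = refl
last-∷ʳ (_ ∷ b ∷ x) c = last-∷ʳ (b ∷ x) c

score-∷ʳ : ∀ x c {ℓ} → last x ≡ just ℓ → score (x ∷ʳ c) ≡ score x ℤ.+ pairScore ℓ c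
score-∷ʳ []          c ()
score-∷ʳ (a ∷ [])    c refl =
  trans (ℤP.+-identityʳ (pairScore a c)) (sym (ℤP.+-identityˡ (pairScore a c)))
score-∷ʳ (a ∷ b ∷ x) c eq   =
  trans (cong (ℤ._+_ (pairScore a b)) (score-∷ʳ (b ∷ x) c eq)) (sym (ℤP.+-assoc (pairScore a b) _ _))

does-shift : ∀ z {d s} t → t ℤ.+ d ≡ s → does (z ℤ.+ d ℤ.≟ s) ≡ does (z ℤ.≟ t)
does-shift z {d} t refl =
  does-⇔ (mk⇔ (∙-cancelʳ d z t) (cong (ℤ._+ d))) (z ℤ.+ d ℤ.≟ t ℤ.+ d) (z ℤ.≟ t)

endCount : Bool → ℤ → List Bool → ℕ
endCount b s x = ⟦ does (isEnd? b s x) ⟧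

H≡Σseq : ∀ s n → H s n ≡ Σseq n (endCount true s)
H≡Σseq s n = length-filter≡sum (isEnd? true s) (allSeqs n)

T≡Σseq : ∀ s n → T s n ≡ Σseq n (endCount false s)
T≡Σseq s n = length-filter≡sum (isEnd? false s) (allSeqs n)

heady-∷ʳ-false : ∀ s x → endCount true s (x ∷ʳ false) ≡ 0
heady-∷ʳ-false s x rewrite last-∷ʳ x false = refl

taily-∷ʳ-true : ∀ s x → endCount false s (x ∷ʳ true) ≡ 0
taily-∷ʳ-true s x rewrite last-∷ʳ x true = refl

heady-∷ʳ-true : ∀ s x {ℓ} → last x ≡ just ℓ →
  endCount true s (x ∷ʳ true) ≡ endCount true (s ℤ.- + 1) x + endCount false s x
heady-∷ʳ-true s x {true} eq rewrite last-∷ʳ x true | score-∷ʳ x true eq | eq =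
  trans (cong ⟦_⟧ (does-shift (score x) (s ℤ.- + 1) (s-1+1≡s s))) (sym (NP.+-identityʳ _))
  where
  s-1+1≡s : ∀ s → s ℤ.- + 1 ℤ.+ + 1 ≡ s
  s-1+1≡s = solve-∀
heady-∷ʳ-true s x {false} eq rewrite last-∷ʳ x true | score-∷ʳ x true eq | eq =
  cong ⟦_⟧ (does-shift (score x) s (ℤP.+-identityʳ s))

taily-∷ʳ-false : ∀ s x {ℓ} → last x ≡ just ℓ →
  endCount false s (x ∷ʳ false) ≡ endCount true (+ 1 ℤ.+ s) x + endCount false s x
taily-∷ʳ-false s x {true} eq rewrite last-∷ʳ x false | score-∷ʳ x false eq | eq =
  trans (cong ⟦_⟧ (does-shift (score x) (+ 1 ℤ.+ s) (1+s-1≡s s))) (sym (NP.+-identityʳ _))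
  where
  1+s-1≡s : ∀ s → + 1 ℤ.+ s ℤ.+ ℤ.- + 1 ≡ s
  1+s-1≡s = solve-∀
taily-∷ʳ-false s x {false} eq rewrite last-∷ʳ x false | score-∷ʳ x false eq | eq =
  cong ⟦_⟧ (does-shift (score x) s (ℤP.+-identityʳ s))

H-one : ∀ s → H s 1 ≡ indic0 s
H-one (+ zero)  = refl
H-one (+ suc _) = refl
H-one -[1+ _ ]  = refl

T-one : ∀ s → T s 1 ≡ indic0 s
T-one (+ zero)  = refl
T-one (+ suc _) = refl
T-one -[1+ _ ]  = refl

H-suc : ∀ n s → H s (2 + n) ≡ H (s ℤ.- + 1) (suc n) + T s (suc n)
H-suc n s = begin
  H s (2 + n)                                       ≡⟨ H≡Σseq s (2 + n) ⟩
  Σseq (2 + n) (endCount true s)                    ≡⟨ Σseq-∷ʳ (suc n) _ ⟩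
  Σseq (suc n) (λ x → endCount true s (x ∷ʳ false)) +
  Σseq (suc n) (λ x → endCount true s (x ∷ʳ true))
    ≡⟨ cong₂ _+_ (trans (Σseq-cong (suc n) (heady-∷ʳ-false s)) (Σseq-0 (suc n)))
                 (Σseq-cong-nonempty n (heady-∷ʳ-true s)) ⟩
  Σseq (suc n) (λ x → endCount true (s ℤ.- + 1) x + endCount false s x)
    ≡⟨ Σseq-+ (suc n) _ _ ⟩
  Σseq (suc n) (endCount true (s ℤ.- + 1)) + Σseq (suc n) (endCount false s)
    ≡⟨ cong₂ _+_ (H≡Σseq (s ℤ.- + 1) (suc n)) (T≡Σseq s (suc n)) ⟨
  H (s ℤ.- + 1) (suc n) + T s (suc n)               ∎
  where open ≡-Reasoning

T-suc : ∀ n s → T s (2 + n) ≡ H (+ 1 ℤ.+ s) (suc n) + T s (suc n)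
T-suc n s = begin
  T s (2 + n)                                       ≡⟨ T≡Σseq s (2 + n) ⟩
  Σseq (2 + n) (endCount false s)                   ≡⟨ Σseq-∷ʳ (suc n) _ ⟩
  Σseq (suc n) (λ x → endCount false s (x ∷ʳ false)) +
  Σseq (suc n) (λ x → endCount false s (x ∷ʳ true))
    ≡⟨ cong₂ _+_ (Σseq-cong-nonempty n (taily-∷ʳ-false s))
                 (trans (Σseq-cong (suc n) (taily-∷ʳ-true s)) (Σseq-0 (suc n))) ⟩
  Σseq (suc n) (λ x → endCount true (+ 1 ℤ.+ s) x + endCount false s x) + 0
    ≡⟨ NP.+-identityʳ _ ⟩
  Σseq (suc n) (λ x → endCount true (+ 1 ℤ.+ s) x + endCount false s x)
    ≡⟨ Σseq-+ (suc n) _ _ ⟩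
  Σseq (suc n) (endCount true (+ 1 ℤ.+ s)) + Σseq (suc n) (endCount false s)
    ≡⟨ cong₂ _+_ (H≡Σseq (+ 1 ℤ.+ s) (suc n)) (T≡Σseq s (suc n)) ⟨
  H (+ 1 ℤ.+ s) (suc n) + T s (suc n)               ∎
  where open ≡-Reasoning

-- Sums over all k satisfying the same recurrences

lowFactor : ℤ → ℕ → ℕ
lowFactor s k = (+ (2 * k) ℤ.+ s) Cℤ k

highFactor : ℤ → ℕ → ℕ
highFactor c k = (c ℤ.- + (2 * k)) Cℤ k

+2[1+j]≡2++2j : ∀ j → + (2 * suc j) ≡ + 2 ℤ.+ + (2 * j)
+2[1+j]≡2++2j j = cong +_ (NP.*-suc 2 j)

lowFactor-pascal : ∀ s j →
  lowFactor s (suc j) ≡ lowFactor (s ℤ.- + 1) (suc j) + lowFactor (+ 1 ℤ.+ s) j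
lowFactor-pascal s j = begin
  (+ (2 * suc j) ℤ.+ s) Cℤ suc j   ≡⟨ cong (_Cℤ suc j) top≡1+a ⟩
  (+ 1 ℤ.+ a) Cℤ suc j             ≡⟨ Cℤ-pascal a j ⟩
  a Cℤ suc j + a Cℤ j              ≡⟨ cong (λ b → b Cℤ suc j + a Cℤ j) a≡top[s-1] ⟩
  lowFactor (s ℤ.- + 1) (suc j) + lowFactor (+ 1 ℤ.+ s) j ∎
  where
  open ≡-Reasoning
  X = + (2 * j)
  a = X ℤ.+ (+ 1 ℤ.+ s)
  2+X+s≡1+a : ∀ X s → + 2 ℤ.+ X ℤ.+ s ≡ + 1 ℤ.+ (X ℤ.+ (+ 1 ℤ.+ s))
  2+X+s≡1+a = solve-∀
  a≡2+X+[s-1] : ∀ X s → X ℤ.+ (+ 1 ℤ.+ s) ≡ + 2 ℤ.+ X ℤ.+ (s ℤ.- + 1)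
  a≡2+X+[s-1] = solve-∀
  top≡1+a : + (2 * suc j) ℤ.+ s ≡ + 1 ℤ.+ a
  top≡1+a = trans (cong (ℤ._+ s) (+2[1+j]≡2++2j j)) (2+X+s≡1+a X s)
  a≡top[s-1] : a ≡ + (2 * suc j) ℤ.+ (s ℤ.- + 1)
  a≡top[s-1] = trans (a≡2+X+[s-1] X s) (cong (ℤ._+ (s ℤ.- + 1)) (sym (+2[1+j]≡2++2j j)))

highFactor-pascal : ∀ c j →
  highFactor (+ 1 ℤ.+ c) (suc j) ≡ highFactor c (suc j) + highFactor (c ℤ.- + 2) j
highFactor-pascal c j = begin
  (+ 1 ℤ.+ c ℤ.- + (2 * suc j)) Cℤ suc j   ≡⟨ cong (_Cℤ suc j) (1+c-Y≡1+[c-Y] c (+ (2 * suc j))) ⟩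
  (+ 1 ℤ.+ b) Cℤ suc j                     ≡⟨ Cℤ-pascal b j ⟩
  b Cℤ suc j + b Cℤ j                      ≡⟨ cong (λ x → b Cℤ suc j + x Cℤ j) b≡c-2-X ⟩
  highFactor c (suc j) + highFactor (c ℤ.- + 2) j ∎
  where
  open ≡-Reasoning
  b = c ℤ.- + (2 * suc j)
  1+c-Y≡1+[c-Y] : ∀ c Y → + 1 ℤ.+ c ℤ.- Y ≡ + 1 ℤ.+ (c ℤ.- Y)
  1+c-Y≡1+[c-Y] = solve-∀
  c-[2+X]≡c-2-X : ∀ c X → c ℤ.- (+ 2 ℤ.+ X) ≡ c ℤ.- + 2 ℤ.- X
  c-[2+X]≡c-2-X = solve-∀
  b≡c-2-X : b ≡ c ℤ.- + 2 ℤ.- + (2 * j)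
  b≡c-2-X = trans (cong (ℤ._-_ c) (+2[1+j]≡2++2j j)) (c-[2+X]≡c-2-X c (+ (2 * j)))

headyTerm : ℕ → ℤ → ℕ → ℕ
headyTerm n s k = lowFactor s k * highFactor (+ n ℤ.- s ℤ.- + 1) k

-- For k ≥ 1 the paper's C(2k+s-1, k-1) C(n-s-2k, k); its k = 0 term 1_{s=0} is added in tailySum.
tailyTerm : ℕ → ℤ → ℕ → ℕ
tailyTerm n s zero    = 0
tailyTerm n s (suc j) = lowFactor (+ 1 ℤ.+ s) j * highFactor (+ n ℤ.- s) (suc j)

1+n-s-1≡n-s : ∀ n s → + 1 ℤ.+ n ℤ.- s ℤ.- + 1 ≡ n ℤ.- s
1+n-s-1≡n-s = solve-∀

n-[s-1]-1≡n-s : ∀ n s → n ℤ.- (s ℤ.- + 1) ℤ.- + 1 ≡ n ℤ.- s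
n-[s-1]-1≡n-s = solve-∀

headyTerm-zero : ∀ n s → headyTerm (suc n) s 0 ≡ headyTerm n (s ℤ.- + 1) 0 + indic0 s
headyTerm-zero n s rewrite 1+n-s-1≡n-s (+ n) s | n-[s-1]-1≡n-s (+ n) s = bySign s
  where
  bySign : ∀ s → lowFactor s 0 * highFactor (+ n ℤ.- s) 0
               ≡ lowFactor (s ℤ.- + 1) 0 * highFactor (+ n ℤ.- s) 0 + indic0 s
  bySign (+ zero)  = refl
  bySign (+ suc _) = sym (NP.+-identityʳ _)
  bySign -[1+ _ ]  = refl

headyTerm-suc : ∀ n s j →
  headyTerm (suc n) s (suc j) ≡ headyTerm n (s ℤ.- + 1) (suc j) + tailyTerm n s (suc j)
headyTerm-suc n s j = begin
  lowFactor s (suc j) * highFactor (+ suc n ℤ.- s ℤ.- + 1) (suc j)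
    ≡⟨ cong₂ _*_ (lowFactor-pascal s j) (cong (λ c → highFactor c (suc j)) (1+n-s-1≡n-s (+ n) s)) ⟩
  (L + lowFactor (+ 1 ℤ.+ s) j) * highFactor (+ n ℤ.- s) (suc j)
    ≡⟨ NP.*-distribʳ-+ (highFactor (+ n ℤ.- s) (suc j)) L _ ⟩
  L * highFactor (+ n ℤ.- s) (suc j) + tailyTerm n s (suc j)
    ≡⟨ cong (λ c → L * highFactor c (suc j) + tailyTerm n s (suc j)) (n-[s-1]-1≡n-s (+ n) s) ⟨
  headyTerm n (s ℤ.- + 1) (suc j) + tailyTerm n s (suc j) ∎
  where
  open ≡-Reasoning
  L = lowFactor (s ℤ.- + 1) (suc j)

tailyTerm-suc : ∀ n s j →
  tailyTerm (suc n) s (suc j) ≡ headyTerm n (+ 1 ℤ.+ s) j + tailyTerm n s (suc j)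
tailyTerm-suc n s j = begin
  L * highFactor (+ suc n ℤ.- s) (suc j)
    ≡⟨ cong (λ c → L * highFactor c (suc j)) (1+n-s≡1+[n-s] (+ n) s) ⟩
  L * highFactor (+ 1 ℤ.+ (+ n ℤ.- s)) (suc j)
    ≡⟨ cong (L *_) (highFactor-pascal (+ n ℤ.- s) j) ⟩
  L * (highFactor (+ n ℤ.- s) (suc j) + highFactor (+ n ℤ.- s ℤ.- + 2) j)
    ≡⟨ NP.*-distribˡ-+ L _ _ ⟩
  tailyTerm n s (suc j) + L * highFactor (+ n ℤ.- s ℤ.- + 2) j
    ≡⟨ NP.+-comm (tailyTerm n s (suc j)) _ ⟩
  L * highFactor (+ n ℤ.- s ℤ.- + 2) j + tailyTerm n s (suc j)
    ≡⟨ cong (λ c → L * highFactor c j + tailyTerm n s (suc j)) (n-s-2≡n-[1+s]-1 (+ n) s) ⟩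
  headyTerm n (+ 1 ℤ.+ s) j + tailyTerm n s (suc j) ∎
  where
  open ≡-Reasoning
  L = lowFactor (+ 1 ℤ.+ s) j
  1+n-s≡1+[n-s] : ∀ n s → + 1 ℤ.+ n ℤ.- s ≡ + 1 ℤ.+ (n ℤ.- s)
  1+n-s≡1+[n-s] = solve-∀
  n-s-2≡n-[1+s]-1 : ∀ n s → n ℤ.- s ℤ.- + 2 ≡ n ℤ.- (+ 1 ℤ.+ s) ℤ.- + 1
  n-s-2≡n-[1+s]-1 = solve-∀

headyTerm-one-zero : ∀ s → headyTerm 1 s 0 ≡ indic0 s
headyTerm-one-zero s =
  trans (cong (λ c → lowFactor s 0 * highFactor c 0) (1-s-1≡-s s)) (bySign s)
  where
  1-s-1≡-s : ∀ s → + 1 ℤ.- s ℤ.- + 1 ≡ ℤ.- s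
  1-s-1≡-s = solve-∀
  bySign : ∀ s → lowFactor s 0 * highFactor (ℤ.- s) 0 ≡ indic0 s
  bySign (+ zero)  = refl
  bySign (+ suc _) = refl
  bySign -[1+ _ ]  = refl

headyTerm-one-suc : ∀ s j → headyTerm 1 s (suc j) ≡ 0
headyTerm-one-suc s j =
  trans (cong (λ c → lowFactor s (suc j) * c Cℤ suc j) (1-s-1-X≡-[X+s] s X))
        (aCℤj*[-a]Cℤ[1+m]≡0 (X ℤ.+ s) (suc j) j)
  where
  X = + (2 * suc j)
  1-s-1-X≡-[X+s] : ∀ s X → + 1 ℤ.- s ℤ.- + 1 ℤ.- X ≡ ℤ.- (X ℤ.+ s)
  1-s-1-X≡-[X+s] = solve-∀

tailyTerm-one : ∀ s k → tailyTerm 1 s k ≡ 0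
tailyTerm-one s zero    = refl
tailyTerm-one s (suc j) =
  trans (cong (λ c → lowFactor (+ 1 ℤ.+ s) j * c Cℤ suc j)
              (trans (cong (λ Y → + 1 ℤ.- s ℤ.- Y) (+2[1+j]≡2++2j j)) (1-s-[2+X]≡-[X+1+s] s X)))
        (aCℤj*[-a]Cℤ[1+m]≡0 (X ℤ.+ (+ 1 ℤ.+ s)) j j)
  where
  X = + (2 * j)
  1-s-[2+X]≡-[X+1+s] : ∀ s X → + 1 ℤ.- s ℤ.- (+ 2 ℤ.+ X) ≡ ℤ.- (X ℤ.+ (+ 1 ℤ.+ s))
  1-s-[2+X]≡-[X+1+s] = solve-∀

headySum : ℕ → ℤ → ℕ → ℕ
headySum n s N = Σ< N (headyTerm n s)

tailySum : ℕ → ℤ → ℕ → ℕ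
tailySum n s N = indic0 s + Σ< N (tailyTerm n s)

headySum-one : ∀ s N → headySum 1 s (suc N) ≡ indic0 s
headySum-one s N = trans (cong₂ _+_ (headyTerm-one-zero s) (Σ<-zero N (λ j _ → headyTerm-one-suc s j)))
                         (NP.+-identityʳ _)

tailySum-one : ∀ s N → tailySum 1 s N ≡ indic0 s
tailySum-one s N = trans (cong (_+_ (indic0 s)) (Σ<-zero N (λ k _ → tailyTerm-one s k)))
                         (NP.+-identityʳ _)

headySum-suc : ∀ n s N →
  headySum (suc n) s (suc N) ≡ headySum n (s ℤ.- + 1) (suc N) + tailySum n s (suc N)
headySum-suc n s N = begin
  headyTerm (suc n) s 0 + Σ< N (λ j → headyTerm (suc n) s (suc j))
    ≡⟨ cong₂ _+_ (headyTerm-zero n s) (trans (Σ<-cong N (headyTerm-suc n s)) (Σ<-+ N _ _)) ⟩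
  (h₀ + indic0 s) + (Σ< N (λ j → headyTerm n (s ℤ.- + 1) (suc j)) + Σₜ)
    ≡⟨ interchange h₀ (indic0 s) _ Σₜ ⟩
  headySum n (s ℤ.- + 1) (suc N) + tailySum n s (suc N) ∎
  where
  open ≡-Reasoning
  h₀ = headyTerm n (s ℤ.- + 1) 0
  Σₜ = Σ< N (λ j → tailyTerm n s (suc j))

tailySum-suc : ∀ n s N →
  tailySum (suc n) s (suc N) ≡ headySum n (+ 1 ℤ.+ s) N + tailySum n s (suc N)
tailySum-suc n s N = begin
  indic0 s + Σ< N (λ j → tailyTerm (suc n) s (suc j))
    ≡⟨ cong (_+_ (indic0 s)) (trans (Σ<-cong N (tailyTerm-suc n s)) (Σ<-+ N _ _)) ⟩
  indic0 s + (headySum n (+ 1 ℤ.+ s) N + Σ< N (λ j → tailyTerm n s (suc j)))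
    ≡⟨ x∙yz≈y∙xz (indic0 s) (headySum n (+ 1 ℤ.+ s) N) _ ⟩
  headySum n (+ 1 ℤ.+ s) N + tailySum n s (suc N) ∎
  where open ≡-Reasoning

counts≡sums : ∀ n N → suc n ≤ N → ∀ s →
  H s (suc n) ≡ headySum (suc n) s N × T s (suc n) ≡ tailySum (suc n) s N
counts≡sums zero    (suc N) _         s =
  trans (H-one s) (sym (headySum-one s N)) , trans (T-one s) (sym (tailySum-one s (suc N)))
counts≡sums (suc n) (suc N) (s≤s n<N) s = heady , taily
  where
  open ≡-Reasoning
  IH : ∀ s → H s (suc n) ≡ headySum (suc n) s (suc N) × T s (suc n) ≡ tailySum (suc n) s (suc N)
  IH = counts≡sums n (suc N) (NP.m≤n⇒m≤1+n n<N)
  heady : H s (2 + n) ≡ headySum (2 + n) s (suc N)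
  heady = begin
    H s (2 + n)                                   ≡⟨ H-suc n s ⟩
    H (s ℤ.- + 1) (suc n) + T s (suc n)           ≡⟨ cong₂ _+_ (proj₁ (IH (s ℤ.- + 1))) (proj₂ (IH s)) ⟩
    headySum (suc n) (s ℤ.- + 1) (suc N) + tailySum (suc n) s (suc N) ≡⟨ headySum-suc (suc n) s N ⟨
    headySum (2 + n) s (suc N)                    ∎
  taily : T s (2 + n) ≡ tailySum (2 + n) s (suc N)
  taily = begin
    T s (2 + n)                                   ≡⟨ T-suc n s ⟩
    H (+ 1 ℤ.+ s) (suc n) + T s (suc n)
      ≡⟨ cong₂ _+_ (proj₁ (counts≡sums n N n<N (+ 1 ℤ.+ s))) (proj₂ (IH s)) ⟩
    headySum (suc n) (+ 1 ℤ.+ s) N + tailySum (suc n) s (suc N) ≡⟨ tailySum-suc (suc n) s N ⟨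
    tailySum (2 + n) s (suc N)                    ∎

-- Cutting the sums down to the stated ranges

lowFactor-below : ∀ s {k} → k < ∣ ℤ.- s ℤ.⊔ + 0 ∣ → lowFactor s k ≡ 0
lowFactor-below (+ zero)  ()
lowFactor-below (+ suc _) ()
lowFactor-below -[1+ q ] {k} k<1+q = m<n+k⇒[m⊖n]Cℤk≡0 (2 * k) (suc q) k 2k<1+q+k
  where
  2k<1+q+k : 2 * k < suc q + k
  2k<1+q+k = subst (_< suc q + k) (cong (_+_ k) (sym (NP.+-identityʳ k))) (NP.+-monoˡ-< k k<1+q)

lowFactor-above : ∀ s {k} → ∣ ℤ.- s ℤ.⊔ + 0 ∣ ≤ k → lowFactor s k ≡ ∣ + (2 * k) ℤ.+ s ∣ C k
lowFactor-above (+ _)    _ = refl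
lowFactor-above -[1+ q ] {k} q<k rewrite ℤP.⊖-≥ (NP.≤-trans q<k (NP.m≤m+n k (k + 0))) = refl

highFactor-nonneg : ∀ c k → highFactor (+ c) k ≡ (c ∸ 2 * k) C k
highFactor-nonneg c zero    = refl
highFactor-nonneg c (suc j) rewrite ℤP.m-n≡m⊖n c (2 * suc j) with 2 * suc j ℕ.≤? c
... | yes 2k≤c rewrite ℤP.⊖-≥ 2k≤c = refl
... | no  2k≰c =
  trans (m<n+k⇒[m⊖n]Cℤk≡0 c (2 * suc j) (suc j) (NP.<-≤-trans c<2k (NP.m≤m+n (2 * suc j) (suc j))))
        (sym (cong (_C suc j) (NP.m≤n⇒m∸n≡0 (NP.<⇒≤ c<2k))))
  where c<2k = NP.≰⇒> 2k≰c

highFactor-neg : ∀ {c} k → ¬ (+ 0 ℤ.≤ c) → highFactor c k ≡ 0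
highFactor-neg {+ _}       k       c≱0 = ⊥-elim (c≱0 (ℤ.+≤+ z≤n))
highFactor-neg { -[1+ _ ]} zero    _   = refl
highFactor-neg { -[1+ _ ]} (suc _) _   = refl

m/2≤q⇒[m+1+q]/3<1+q : ∀ {m q} → m / 2 ≤ q → (m + suc q) / 3 < suc q
m/2≤q⇒[m+1+q]/3<1+q {m} {q} m/2≤q =
  m<n*o⇒m/o<n (subst (m + suc q <_) 3[1+q] (NP.+-monoˡ-< (suc q) (m/n<o⇒m<o*n (s≤s m/2≤q))))
  where
  3[1+q] : suc q * 2 + suc q ≡ suc q * 3
  3[1+q] = sym (trans (NP.*-suc (suc q) 2) (NP.+-comm (suc q) _))

-x≰-[1+q]⇒x≤q : ∀ {x q} → ¬ (ℤ.- + x ℤ.≤ -[1+ q ]) → x ≤ q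
-x≰-[1+q]⇒x≤q {zero}  _   = z≤n
-x≰-[1+q]⇒x≤q {suc x} -x≰ = NP.≰⇒> (λ q≤x → -x≰ (ℤ.-≤- q≤x))

∣-s⊔1∣≡1+∣-[1+s]⊔0∣ : ∀ s → ∣ ℤ.- s ℤ.⊔ + 1 ∣ ≡ suc ∣ ℤ.- (+ 1 ℤ.+ s) ℤ.⊔ + 0 ∣
∣-s⊔1∣≡1+∣-[1+s]⊔0∣ (+ zero)     = refl
∣-s⊔1∣≡1+∣-[1+s]⊔0∣ (+ suc _)    = refl
∣-s⊔1∣≡1+∣-[1+s]⊔0∣ -[1+ zero ]  = refl
∣-s⊔1∣≡1+∣-[1+s]⊔0∣ -[1+ suc _ ] = refl

n-1-s≡n-s-1 : ∀ n s → n ℤ.- + 1 ℤ.- s ≡ n ℤ.- s ℤ.- + 1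
n-1-s≡n-s-1 = solve-∀

headySummand : ℕ → ℤ → ℕ → ℕ
headySummand n s k = (∣ + (2 * k) ℤ.+ s ∣ C k) * ((∣ + n ℤ.- s ℤ.- + 1 ∣ ∸ 2 * k) C k)

headyFormula : ℕ → ℤ → ℕ
headyFormula n s = sumFromTo ∣ ℤ.- s ℤ.⊔ + 0 ∣ (∣ + n ℤ.- s ℤ.- + 1 ∣ / 3) (headySummand n s)

tailySummand : ℕ → ℤ → ℕ → ℕ
tailySummand n s k = (∣ + (2 * k) ℤ.+ s ℤ.- + 1 ∣ C (k ∸ 1)) * ((∣ + n ℤ.- s ∣ ∸ 2 * k) C k)

tailyFormula : ℕ → ℤ → ℕ
tailyFormula n s = indic0 s + sumFromTo ∣ ℤ.- s ℤ.⊔ + 1 ∣ (∣ + n ℤ.- s ∣ / 3) (tailySummand n s)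

H≡headyFormula : ∀ m s → s ℤ.≤ + suc m ℤ.- + 1 → H s (suc m) ≡ headyFormula (suc m) s
H≡headyFormula m s s≤n-1 = begin
  H s n                  ≡⟨ proj₁ (counts≡sums m N (NP.m≤n+m n _) s) ⟩
  Σ< N (headyTerm n s)   ≡⟨ Σ<-support lo hi n below agree above ⟩
  headyFormula n s       ∎
  where
  open ≡-Reasoning
  n = suc m
  c = + n ℤ.- s ℤ.- + 1
  lo = ∣ ℤ.- s ℤ.⊔ + 0 ∣
  hi = ∣ c ∣ / 3
  N = lo + (suc hi ∸ lo) + n
  c≡+∣c∣ : c ≡ + ∣ c ∣
  c≡+∣c∣ = sym (ℤP.0≤i⇒+∣i∣≡i (subst (+ 0 ℤ.≤_) (n-1-s≡n-s-1 (+ n) s) (ℤP.i≤j⇒0≤j-i s≤n-1)))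
  below : ∀ k → k < lo → headyTerm n s k ≡ 0
  below k k<lo = cong (_* highFactor c k) (lowFactor-below s k<lo)
  agree : ∀ k → lo ≤ k → headyTerm n s k ≡ headySummand n s k
  agree k lo≤k = cong₂ _*_ (lowFactor-above s lo≤k)
                           (trans (cong (λ c → highFactor c k) c≡+∣c∣) (highFactor-nonneg ∣ c ∣ k))
  above : ∀ k → hi < k → headySummand n s k ≡ 0
  above k hi<k = trans (cong (_*_ (∣ + (2 * k) ℤ.+ s ∣ C k)) (c/3<k⇒[c∸2k]Ck≡0 ∣ c ∣ hi<k))
                       (NP.*-zeroʳ (∣ + (2 * k) ℤ.+ s ∣ C k))

T≡tailyFormula : ∀ m s → s ℤ.≤ + suc m → T s (suc m) ≡ tailyFormula (suc m) s
T≡tailyFormula m s s≤n = begin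
  T s n                             ≡⟨ proj₂ (counts≡sums m N (NP.m≤n+m n _) s) ⟩
  indic0 s + Σ< N (tailyTerm n s)   ≡⟨ cong (_+_ (indic0 s)) (Σ<-support lo hi n below agree above) ⟩
  tailyFormula n s                  ∎
  where
  open ≡-Reasoning
  n = suc m
  c = + n ℤ.- s
  lo = ∣ ℤ.- s ℤ.⊔ + 1 ∣
  hi = ∣ c ∣ / 3
  N = lo + (suc hi ∸ lo) + n
  lo≡ = ∣-s⊔1∣≡1+∣-[1+s]⊔0∣ s
  c≡+∣c∣ : c ≡ + ∣ c ∣
  c≡+∣c∣ = sym (ℤP.0≤i⇒+∣i∣≡i (ℤP.i≤j⇒0≤j-i s≤n))
  X+[1+s]≡2+X+s-1 : ∀ X s → X ℤ.+ (+ 1 ℤ.+ s) ≡ + 2 ℤ.+ X ℤ.+ s ℤ.- + 1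
  X+[1+s]≡2+X+s-1 = solve-∀
  top≡ : ∀ j → + (2 * j) ℤ.+ (+ 1 ℤ.+ s) ≡ + (2 * suc j) ℤ.+ s ℤ.- + 1
  top≡ j = trans (X+[1+s]≡2+X+s-1 (+ (2 * j)) s) (cong (λ Y → Y ℤ.+ s ℤ.- + 1) (sym (+2[1+j]≡2++2j j)))
  below : ∀ k → k < lo → tailyTerm n s k ≡ 0
  below zero    _    = refl
  below (suc j) k<lo = cong (_* highFactor c (suc j))
    (lowFactor-below (+ 1 ℤ.+ s) (NP.≤-pred (subst (suc j <_) lo≡ k<lo)))
  agree : ∀ k → lo ≤ k → tailyTerm n s k ≡ tailySummand n s k
  agree zero    lo≤0 with () ← subst (_≤ 0) lo≡ lo≤0
  agree (suc j) lo≤k = cong₂ _*_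
    (trans (lowFactor-above (+ 1 ℤ.+ s) (NP.≤-pred (subst (_≤ suc j) lo≡ lo≤k)))
           (cong (λ x → ∣ x ∣ C j) (top≡ j)))
    (trans (cong (λ c → highFactor c (suc j)) c≡+∣c∣) (highFactor-nonneg ∣ c ∣ (suc j)))
  above : ∀ k → hi < k → tailySummand n s k ≡ 0
  above k hi<k =
    trans (cong (_*_ (∣ + (2 * k) ℤ.+ s ℤ.- + 1 ∣ C (k ∸ 1))) (c/3<k⇒[c∸2k]Ck≡0 ∣ c ∣ hi<k))
          (NP.*-zeroʳ (∣ + (2 * k) ℤ.+ s ℤ.- + 1 ∣ C (k ∸ 1)))

headyFormula-below : ∀ m s → ¬ (ℤ.- + (m / 2) ℤ.≤ s) → headyFormula (suc m) s ≡ 0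
headyFormula-below m (+ _)    s≱ = ⊥-elim (s≱ ℤP.neg-≤-pos)
headyFormula-below m -[1+ q ] s≱ =
  sumFromTo-empty (headySummand (suc m) -[1+ q ]) (m/2≤q⇒[m+1+q]/3<1+q {m} (-x≰-[1+q]⇒x≤q s≱))

tailyFormula-below : ∀ n s → ¬ (ℤ.- + (n / 2) ℤ.≤ s) → tailyFormula n s ≡ 0
tailyFormula-below n (+ _)    s≱ = ⊥-elim (s≱ ℤP.neg-≤-pos)
tailyFormula-below n -[1+ q ] s≱ = sumFromTo-empty (tailySummand n -[1+ q ])
  (NP.<-≤-trans (m/2≤q⇒[m+1+q]/3<1+q {n} (-x≰-[1+q]⇒x≤q s≱)) (s≤s (NP.m≤m⊔n q 0)))

tailyFormula-above : ∀ n s → ¬ (s ℤ.≤ + (n ∸ 3)) → s ℤ.≤ + n → tailyFormula n s ≡ 0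
tailyFormula-above n -[1+ _ ] s≰ _             = ⊥-elim (s≰ ℤ.-≤+)
tailyFormula-above n (+ zero) s≰ _             = ⊥-elim (s≰ (ℤ.+≤+ z≤n))
tailyFormula-above n (+ suc p) s≰ (ℤ.+≤+ p<n) =
  sumFromTo-empty (tailySummand n (+ suc p)) (subst (_< 1) (sym hi≡0) (s≤s z≤n))
  where
  n∸3≤p : n ∸ 3 ≤ p
  n∸3≤p = NP.≤-pred (NP.≰⇒> (λ 1+p≤n∸3 → s≰ (ℤ.+≤+ 1+p≤n∸3)))
  n<1+p+3 : n < suc p + 3
  n<1+p+3 = NP.≤-<-trans (NP.m≤n+m∸n n 3)
              (NP.≤-<-trans (NP.+-monoʳ-≤ 3 n∸3≤p)
                            (subst (_< suc p + 3) (NP.+-comm p 3) (NP.n<1+n (p + 3))))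
  hi≡0 : ∣ + n ℤ.- + suc p ∣ / 3 ≡ 0
  hi≡0 = trans (cong (λ x → ∣ x ∣ / 3) (trans (ℤP.m-n≡m⊖n n (suc p)) (ℤP.⊖-≥ p<n)))
               (m<n⇒m/n≡0 (NP.m<n+o⇒m∸n<o n (suc p) n<1+p+3))

H-above : ∀ m s → ¬ (s ℤ.≤ + suc m ℤ.- + 1) → H s (suc m) ≡ 0
H-above m s s≰ = trans (proj₁ (counts≡sums m (suc m) NP.≤-refl s)) (Σ<-zero (suc m) vanish)
  where
  c≱0 : ¬ (+ 0 ℤ.≤ + suc m ℤ.- s ℤ.- + 1)
  c≱0 0≤c = s≰ (ℤP.0≤i-j⇒j≤i (subst (+ 0 ℤ.≤_) (sym (n-1-s≡n-s-1 (+ suc m) s)) 0≤c))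
  vanish : ∀ k → k < suc m → headyTerm (suc m) s k ≡ 0
  vanish k _ = trans (cong (lowFactor s k *_) (highFactor-neg k c≱0)) (NP.*-zeroʳ (lowFactor s k))

T-above : ∀ m s → ¬ (s ℤ.≤ + suc m) → T s (suc m) ≡ 0
T-above m (+ zero)  s≰ = ⊥-elim (s≰ (ℤ.+≤+ z≤n))
T-above m -[1+ _ ]  s≰ = ⊥-elim (s≰ ℤ.-≤+)
T-above m (+ suc p) s≰ =
  trans (proj₂ (counts≡sums m (suc m) NP.≤-refl (+ suc p))) (Σ<-zero (suc m) vanish)
  where
  L : ℕ → ℕ
  L j = lowFactor (+ 1 ℤ.+ + suc p) j
  vanish : ∀ k → k < suc m → tailyTerm (suc m) (+ suc p) k ≡ 0
  vanish zero    _ = refl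
  vanish (suc j) _ =
    trans (cong (L j *_) (highFactor-neg (suc j) (λ 0≤c → s≰ (ℤP.0≤i-j⇒j≤i 0≤c)))) (NP.*-zeroʳ (L j))

H-outside : ∀ m s → ¬ (ℤ.- + (m / 2) ℤ.≤ s × s ℤ.≤ + suc m ℤ.- + 1) → H s (suc m) ≡ 0
H-outside m s out with s ℤ.≤? + suc m ℤ.- + 1
... | yes s≤n-1 =
  trans (H≡headyFormula m s s≤n-1) (headyFormula-below m s (λ s≥ → out (s≥ , s≤n-1)))
... | no  s≰n-1 = H-above m s s≰n-1

≤n∸3⇒≤n : ∀ {s} n → s ℤ.≤ + (n ∸ 3) → s ℤ.≤ + n
≤n∸3⇒≤n n s≤ = ℤP.≤-trans s≤ (ℤ.+≤+ (NP.m∸n≤m n 3))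

T-outside : ∀ m s → ¬ (ℤ.- + (suc m / 2) ℤ.≤ s × s ℤ.≤ + (suc m ∸ 3)) → T s (suc m) ≡ 0
T-outside m s out with s ℤ.≤? + (suc m ∸ 3) | s ℤ.≤? + suc m
... | yes s≤n∸3 | _       = trans (T≡tailyFormula m s (≤n∸3⇒≤n (suc m) s≤n∸3))
                                  (tailyFormula-below (suc m) s (λ s≥ → out (s≥ , s≤n∸3)))
... | no s≰n∸3  | yes s≤n = trans (T≡tailyFormula m s s≤n) (tailyFormula-above (suc m) s s≰n∸3 s≤n)
... | no _      | no s≰n  = T-above m s s≰n

theorem2 : (n : ℕ) (s : ℤ) → 1 ℕ.≤ n →
    ((ℤ.- + ((n ∸ 1) / 2) ℤ.≤ s × s ℤ.≤ + n ℤ.- + 1 →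
        H s n ≡ sumFromTo ∣ (ℤ.- s) ℤ.⊔ + 0 ∣ (∣ + n ℤ.- s ℤ.- + 1 ∣ / 3)
          (λ k → (∣ + (2 ℕ.* k) ℤ.+ s ∣ C k)
                 ℕ.* ((∣ + n ℤ.- s ℤ.- + 1 ∣ ∸ 2 ℕ.* k) C k)))
    × (¬ (ℤ.- + ((n ∸ 1) / 2) ℤ.≤ s × s ℤ.≤ + n ℤ.- + 1) → H s n ≡ 0))
    × ((ℤ.- + (n / 2) ℤ.≤ s × s ℤ.≤ + (n ∸ 3) →
        T s n ≡ indic0 s ℕ.+ sumFromTo (∣ (ℤ.- s) ℤ.⊔ + 1 ∣) (∣ + n ℤ.- s ∣ / 3)
          (λ k → (∣ + (2 ℕ.* k) ℤ.+ s ℤ.- + 1 ∣ C (k ∸ 1))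
                 ℕ.* ((∣ + n ℤ.- s ∣ ∸ 2 ℕ.* k) C k)))
    × (¬ (ℤ.- + (n / 2) ℤ.≤ s × s ℤ.≤ + (n ∸ 3)) → T s n ≡ 0))
theorem2 (suc m) s _ =
  ( (λ (_ , s≤n-1) → H≡headyFormula m s s≤n-1) , H-outside m s )
  , ( (λ (_ , s≤n∸3) → T≡tailyFormula m s (≤n∸3⇒≤n (suc m) s≤n∸3)) , T-outside m s )
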